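{- Let $s\geq 1$ be an integer, let $\mathcal{C}$ be a finite class of biconnected graphs and let $d$ be the maximum number of vertices of a graph in $\mathcal{C}$. Let $G$ be an $sP_3$-free graph, let $X\subseteq V(G)$ be such that $F=G[X]$ is a $\mathcal{C}$-block graph, and let $F'$ be obtained from $F$ by removing all trivial components. Then, for any choice of roots of the block-cut forest of $F'$, at most $d\cdot(s-1)$ vertices of $F'$ are terminals of type 1.
   Context: A connected graph on at least two vertices is biconnected if deleting any single vertex leaves it connected; a block is an inclusion-wise maximal biconnected subgraph; a $\mathcal{C}$-block graph is a graph every block of which is isomorphic to a member of $\mathcal{C}$. A graph is $sP_3$-free if it has no induced subgraph isomorphic to the disjoint union of $s$ copies of the 3-vertex path. A component of $F$ is trivial if it is a single vertex or a single block. The block-cut forest of $F'$ has as vertices the cutvertices and the blocks of $F'$, with an edge $xb$ whenever cutvertex $x$ belongs to block $b$; in each component of $F'$ an arbitrary cutvertex is chosen as root, giving a parent–child relation. Leaves of this forest are blocks, called leaf blocks. A cutvertex $x$ of $F'$ is a terminal of type 1 if it has at least two children in the block-cut forest that are leaves; it is a terminal of type 2 if some leaf block has $x$ as its great-grandparent in the block-cut forest. -}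

module Defs where

open import Data.Nat using (ℕ; _⊔_)
open import Data.Fin using (Fin)
import Data.Fin.Subset
open import Data.Unit using (⊤)
open import Data.Fin.Subset using (Subset; _∈_; _⊆_; _-_)
open import Data.Bool using (Bool; true; false)
open import Data.List using (List; []; _∷_; foldr; map)
open import Data.List.Relation.Unary.Any using (Any)
open import Data.List.Relation.Unary.All using (All)
open import Data.List.Relation.Unary.Unique.Propositional using (Unique)
open import Data.Product using (Σ; ∃; ∃-syntax; _×_; _,_)
open import Data.Sum using (_⊎_)
open import Relation.Nullary using (¬_)
open import Data.Empty using (⊥)
open import Relation.Binary.PropositionalEquality using (_≡_; _≢_)
open import Function.Bundles using (_⇔_)
open import Function.Definitions using (Injective)

record Graph : Set where
  field
    n      : ℕ
    adj    : Fin n → Fin n → Bool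
    sym    : ∀ u v → adj u v ≡ adj v u
    irrefl : ∀ v → adj v v ≡ false

open Graph public

Edge : (G : Graph) → Fin (n G) → Fin (n G) → Set
Edge G u v = adj G u v ≡ true

module _ (G : Graph) where

  V : Set
  V = Fin (n G)

  data PathIn (S : Subset (n G)) : V → V → Set where
    here : ∀ {v} → v ∈ S → PathIn S v v
    step : ∀ {u w v} → u ∈ S → Edge G u w → PathIn S w v → PathIn S u v

  Connected : Subset (n G) → Set
  Connected S = ∀ u v → u ∈ S → v ∈ S → PathIn S u v

  Biconnected : Subset (n G) → Set
  Biconnected S =
    (∃[ u ] ∃[ v ] (u ∈ S × v ∈ S × u ≢ v)) × Connected S
    × (∀ x → x ∈ S → Connected (S - x))

  Block : Subset (n G) → Subset (n G) → Set
  Block X B = B ⊆ X × Biconnected B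
    × (∀ B' → B ⊆ B' → B' ⊆ X → Biconnected B' → B' ≡ B)

  IsoTo : Graph → Subset (n G) → Set
  IsoTo H B = Σ (Fin (n H) → V) λ f →
    Injective _≡_ _≡_ f × (∀ i → f i ∈ B) × (∀ v → v ∈ B → ∃[ i ] f i ≡ v)
    × (∀ i j → Edge H i j ⇔ Edge G (f i) (f j))

  BlockGraph : List Graph → Subset (n G) → Set
  BlockGraph C X = ∀ B → Block X B → Any (λ H → IsoTo H B) C

  TrivialComp : Subset (n G) → V → Set
  TrivialComp X v =
    (∀ u → PathIn X v u → u ≡ v)
    ⊎ (∃[ B ] (Block X B × (∀ u → (u ∈ B) ⇔ PathIn X v u)))

  RemoveTrivial : Subset (n G) → Subset (n G) → Set
  RemoveTrivial X X' = ∀ v → (v ∈ X') ⇔ (v ∈ X × ¬ TrivialComp X v)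

  CutVertex : Subset (n G) → V → Set
  CutVertex Y x = x ∈ Y × ∃[ u ] ∃[ w ]
    (u ∈ Y - x × w ∈ Y - x × PathIn Y u w × ¬ PathIn (Y - x) u w)

  -- nodes of the block-cut forest of G[Y]
  data Node : Set where
    cv : V → Node
    bl : Subset (n G) → Node

  BCAdj : Subset (n G) → Node → Node → Set
  BCAdj Y (cv x) (bl B) = CutVertex Y x × Block Y B × x ∈ B
  BCAdj Y (bl B) (cv x) = CutVertex Y x × Block Y B × x ∈ B
  BCAdj Y (cv _) (cv _) = ⊥
  BCAdj Y (bl _) (bl _) = ⊥

  -- walks in the block-cut forest of G[Y] from a to b; the list records
  -- the visited nodes (most recent first)
  data BCWalk (Y : Subset (n G)) (a : Node) : Node → List Node → Set where
    start  : BCWalk Y a a (a ∷ [])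
    extend : ∀ {b c vs} → BCWalk Y a b vs → BCAdj Y b c → BCWalk Y a c (c ∷ vs)

  -- a choice of roots: every component of G[Y] gets an arbitrary cutvertex
  -- as root; root v is the root of the component containing v
  RootChoice : Subset (n G) → (V → V) → Set
  RootChoice Y root =
    (∀ v → v ∈ Y → CutVertex Y (root v) × PathIn Y v (root v))
    × (∀ u v → u ∈ Y → PathIn Y u v → root u ≡ root v)

  RootOf : (V → V) → Node → V → Set
  RootOf root (cv x) r = r ≡ root x
  RootOf root (bl B) r = ∃[ v ] (v ∈ B × r ≡ root v)

  -- c is a child of p in the rooted block-cut forest: p precedes c on the
  -- (unique) path from the root to c
  Child : Subset (n G) → (V → V) → Node → Node → Set
  Child Y root p c = ∃[ r ] (RootOf root p r
    × ∃[ vs ] (BCWalk Y (cv r) p vs × Unique (c ∷ vs) × BCAdj Y p c))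

  LeafBlock : Subset (n G) → (V → V) → Subset (n G) → Set
  LeafBlock Y root B = Block Y B × (∀ c → ¬ Child Y root (bl B) c)

  Type1 : Subset (n G) → (V → V) → V → Set
  Type1 Y root x = CutVertex Y x × ∃[ B₁ ] ∃[ B₂ ] (B₁ ≢ B₂
    × Child Y root (cv x) (bl B₁) × LeafBlock Y root B₁
    × Child Y root (cv x) (bl B₂) × LeafBlock Y root B₂)

P3adj : Fin 3 → Fin 3 → Set
P3adj Fin.zero (Fin.suc Fin.zero) = ⊤
P3adj (Fin.suc Fin.zero) Fin.zero = ⊤
P3adj (Fin.suc Fin.zero) (Fin.suc (Fin.suc Fin.zero)) = ⊤
P3adj (Fin.suc (Fin.suc Fin.zero)) (Fin.suc Fin.zero) = ⊤
P3adj _ _ = ⊥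

sP3adj : (s : ℕ) → Fin s × Fin 3 → Fin s × Fin 3 → Set
sP3adj s (i , a) (j , b) = i ≡ j × P3adj a b

sP3Free : ℕ → Graph → Set
sP3Free s G = ¬ (Σ (Fin s × Fin 3 → V G) λ f → Injective _≡_ _≡_ f
  × (∀ p q → Edge G (f p) (f q) ⇔ sP3adj s p q))

BiconnectedGraph : Graph → Set
BiconnectedGraph H = Biconnected H Data.Fin.Subset.⊤

maxOrder : List Graph → ℕ
maxOrder C = foldr _⊔_ 0 (map n C)

-- Every type-1 terminal x has two leaf children B₁ ≠ B₂ in the block-cut forest; a neighbour of x
-- in each gives an induced P₃ through x (a cherry). No vertex of a leaf block other than its parent
-- has a neighbour outside the block, for it would be a cutvertex, i.e. a further child; hence the
-- cherries of distinct non-adjacent terminals are disjoint and anticomplete. The terminals lie in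
-- the C-block graph G[X], whose biconnected subgraphs have at most d vertices. The head of a maximal
-- path through a set R of terminals has all its R-neighbours on that path, and the last of them
-- closes a cycle, so some terminal has at most d - 1 neighbours in R. Greedily, more than d(s - 1)
-- terminals thus contain s pairwise non-adjacent ones, whose cherries form an induced sP₃.

module Submission where

open import Defs hiding (sym)
open import Data.Nat using (ℕ; zero; suc; _≤_; _<_; _*_; _∸_; _+_; z≤n; s≤s; _≤?_)
open import Data.Nat.Properties
  using ( ≤-refl; ≤-trans; <⇒≱; ≰⇒>; m≤m+n; m≤m⊔n; m≤n⊔m; +-suc; *-suc; +-mono-≤; +-cancelˡ-<
        ; module ≤-Reasoning)
open import Data.Bool using (true) renaming (_≟_ to _≟ᵇ_)
open import Data.Empty using (⊥; ⊥-elim)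
open import Data.Unit using (tt)
open import Data.Product using (Σ; ∃-syntax; _×_; _,_; proj₁; proj₂)
open import Data.Sum using (_⊎_; inj₁; inj₂; map₂)
open import Data.Fin using (Fin; zero; suc; _≟_)
open import Data.Fin.Properties using (any?)
open import Data.Vec using (_∷_; here; there)
open import Data.Fin.Subset using (Subset; _∈_; _∉_; _⊆_; _⊂_; _⊃_; _-_; _─_; ⁅_⁆; _∪_; inside; outside)
import Data.Fin.Subset as Subset
open import Data.Fin.Subset.Properties
  using ( _∈?_; x∈⁅x⁆; x∈⁅y⁆⇒x≡y; x∈p∪q⁻; x∈p∪q⁺; ∉⊥; x∈p∧x∉q⇒x∈p─q; p─q⊆p
        ; ∪-assoc; ∪-identityˡ; ⊆-antisym)
open import Data.Fin.Subset.Induction using (⊃-wellFounded; Acc; acc)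
open import Data.List using (List; []; _∷_; _++_; length; filter; map; allFin)
open import Data.List.Properties using (length-map; length-tabulate; ++-assoc)
open import Data.List.Relation.Unary.Any using (Any; here; there)
import Data.List.Relation.Unary.Any as Any
open import Data.List.Relation.Unary.All using (All; []; _∷_)
import Data.List.Relation.Unary.All as All
open import Data.List.Relation.Unary.All.Properties using (¬Any⇒All¬; ++⁻ʳ; ++⁻ˡ)
import Data.List.Relation.Unary.All.Properties as Allₚ
open import Data.List.Relation.Unary.AllPairs using ([]; _∷_)
open import Data.List.Relation.Unary.Unique.Propositional using (Unique)
import Data.List.Relation.Unary.Unique.Propositional.Properties as Uniqueₚ
open import Data.List.Membership.Propositional using (find) renaming (_∈_ to _∈ˡ_)
open import Data.List.Membership.Propositional.Properties
  using (∈-∃++; ∈-map⁺; ∈-map⁻; ∈-allFin; ∈-filter⁻; ∈-++⁻; ∈-++⁺ˡ; ∈-++⁺ʳ)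
open import Data.List.Relation.Binary.Subset.Propositional using () renaming (_⊆_ to _⊆ˡ_)
open import Function using (_∘_; id; case_of_)
open import Function.Bundles using (_⇔_; mk⇔; Equivalence)
open import Function.Definitions using (Injective)
open import Relation.Nullary using (¬_; Dec; yes; no; ¬?; contradiction)
open import Relation.Nullary.Decidable using (_×-dec_)
open import Relation.Binary.PropositionalEquality
  using (_≡_; _≢_; refl; sym; trans; cong; subst; module ≡-Reasoning)

module _ {A : Set} where

  Unique-++⁻ʳ : ∀ (xs : List A) {ys} → Unique (xs ++ ys) → Unique ys
  Unique-++⁻ʳ []       u       = u
  Unique-++⁻ʳ (x ∷ xs) (_ ∷ u) = Unique-++⁻ʳ xs u

  Unique-++⁻ˡ : ∀ (xs : List A) {ys} → Unique (xs ++ ys) → Unique xs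
  Unique-++⁻ˡ []       _         = []
  Unique-++⁻ˡ (x ∷ xs) (x∉ ∷ u) = ++⁻ˡ xs x∉ ∷ Unique-++⁻ˡ xs u

  Unique⇒length≤ : ∀ {xs ys : List A} → Unique xs → xs ⊆ˡ ys → length xs ≤ length ys
  Unique⇒length≤ {[]}     _              _     = z≤n
  Unique⇒length≤ {x ∷ xs} {ys} (x∉xs ∷ xs!) xs⊆ys =
    ≤-trans (s≤s (Unique⇒length≤ xs! (λ y∈xs → remove-∈ x∈ys (xs⊆ys (there y∈xs)) (x≢y y∈xs))))
            (length-remove x∈ys)
    where
    x∈ys : x ∈ˡ ys
    x∈ys = xs⊆ys (here refl)

    x≢y : ∀ {y} → y ∈ˡ xs → y ≢ x
    x≢y y∈xs refl = All.lookup x∉xs y∈xs refl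

    remove : ∀ {zs} → x ∈ˡ zs → List A
    remove {_ ∷ zs} (here _)  = zs
    remove {z ∷ _}  (there i) = z ∷ remove i

    length-remove : ∀ {zs} (i : x ∈ˡ zs) → suc (length (remove i)) ≤ length zs
    length-remove (here _)  = s≤s ≤-refl
    length-remove (there i) = s≤s (length-remove i)

    remove-∈ : ∀ {y zs} (i : x ∈ˡ zs) → y ∈ˡ zs → y ≢ x → y ∈ˡ remove i
    remove-∈ (here refl) (here refl) y≢x = contradiction refl y≢x
    remove-∈ (here refl) (there j)   _   = j
    remove-∈ (there i)   (here y≡z)  _   = here y≡z
    remove-∈ (there i)   (there j)   y≢x = there (remove-∈ i j y≢x)

  module _ {P : A → Set} (P? : ∀ x → Dec (P x)) where

    length-filter-+ : ∀ xs → length (filter P? xs) + length (filter (¬? ∘ P?) xs) ≡ length xs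
    length-filter-+ []       = refl
    length-filter-+ (x ∷ xs) with P? x
    ... | yes _ = cong suc (length-filter-+ xs)
    ... | no  _ = trans (+-suc _ _) (cong suc (length-filter-+ xs))

    split-last : ∀ xs → All (¬_ ∘ P) xs ⊎
                 ∃[ ys ] ∃[ y ] ∃[ zs ] (xs ≡ ys ++ y ∷ zs × P y × All (¬_ ∘ P) zs)
    split-last []       = inj₁ []
    split-last (x ∷ xs) with split-last xs
    ... | inj₂ (ys , y , zs , refl , py , zs¬P) = inj₂ (x ∷ ys , y , zs , refl , py , zs¬P)
    ... | inj₁ xs¬P with P? x
    ...   | yes px = inj₂ ([] , x , xs , refl , px , xs¬P)
    ...   | no ¬px = inj₁ (¬px ∷ xs¬P)

private variable m : ℕ

x∈p─q⇒x∉q : ∀ (p q : Subset m) {x} → x ∈ p ─ q → x ∉ q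
x∈p─q⇒x∉q (inside  ∷ p) (outside ∷ q)         here       = λ ()
x∈p─q⇒x∉q (outside ∷ p) (outside ∷ q) {zero}  ()
x∈p─q⇒x∉q (outside ∷ p) (inside  ∷ q) {zero}  ()
x∈p─q⇒x∉q (inside  ∷ p) (inside  ∷ q) {zero}  ()
x∈p─q⇒x∉q (_       ∷ p) (_       ∷ q)         (there x∈) (there x∈q) = x∈p─q⇒x∉q p q x∈ x∈q

x∈p-y⁻ : ∀ {p : Subset m} {x y} → x ∈ p - y → x ∈ p × x ≢ y
x∈p-y⁻ {p = p} {y = y} x∈ = p─q⊆p p ⁅ y ⁆ x∈ , λ { refl → x∈p─q⇒x∉q p ⁅ y ⁆ x∈ (x∈⁅x⁆ y) }

x∈p-y⁺ : ∀ {p : Subset m} {x y} → x ∈ p → x ≢ y → x ∈ p - y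
x∈p-y⁺ {y = y} x∈p x≢y = x∈p∧x∉q⇒x∈p─q x∈p (x≢y ∘ x∈⁅y⁆⇒x≡y y)

⊆⇒≡⊎⊂ : ∀ {p q : Subset m} → p ⊆ q → q ≡ p ⊎ p ⊂ q
⊆⇒≡⊎⊂ {p = p} {q} p⊆q with any? (λ x → x ∈? q ×-dec ¬? (x ∈? p))
... | yes (x , x∈q , x∉p) = inj₂ (p⊆q , x , x∈q , x∉p)
... | no ∄ = inj₁ (⊆-antisym q⊆p p⊆q)
  where
  q⊆p : q ⊆ p
  q⊆p {x} x∈q with x ∈? p
  ... | yes x∈p = x∈p
  ... | no  x∉p = contradiction (x , x∈q , x∉p) ∄

fromList : List (Fin m) → Subset m
fromList []       = Subset.⊥
fromList (v ∷ vs) = ⁅ v ⁆ ∪ fromList vs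

∈-fromList⁺ : ∀ {x : Fin m} vs → x ∈ˡ vs → x ∈ fromList vs
∈-fromList⁺ (v ∷ _)  (here refl) = x∈p∪q⁺ (inj₁ (x∈⁅x⁆ v))
∈-fromList⁺ (_ ∷ vs) (there x∈)  = x∈p∪q⁺ (inj₂ (∈-fromList⁺ vs x∈))

∈-fromList⁻ : ∀ {x : Fin m} vs → x ∈ fromList vs → x ∈ˡ vs
∈-fromList⁻ []       x∈ = contradiction x∈ ∉⊥
∈-fromList⁻ (v ∷ vs) x∈ with x∈p∪q⁻ ⁅ v ⁆ (fromList vs) x∈
... | inj₁ x∈v  = here (x∈⁅y⁆⇒x≡y v x∈v)
... | inj₂ x∈vs = there (∈-fromList⁻ vs x∈vs)

fromList-++ : ∀ (xs ys : List (Fin m)) → fromList (xs ++ ys) ≡ fromList xs ∪ fromList ys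
fromList-++ []       ys = sym (∪-identityˡ (fromList ys))
fromList-++ (x ∷ xs) ys = begin
  ⁅ x ⁆ ∪ fromList (xs ++ ys)            ≡⟨ cong (⁅ x ⁆ ∪_) (fromList-++ xs ys) ⟩
  ⁅ x ⁆ ∪ (fromList xs ∪ fromList ys)   ≡⟨ ∪-assoc ⁅ x ⁆ (fromList xs) (fromList ys) ⟨
  (⁅ x ⁆ ∪ fromList xs) ∪ fromList ys   ∎
  where open ≡-Reasoning

p⊆q⇒p-x⊆q-x : ∀ {p q : Subset m} {x} → p ⊆ q → p - x ⊆ q - x
p⊆q⇒p-x⊆q-x p⊆q y∈ with x∈p-y⁻ y∈
... | y∈p , y≢x = x∈p-y⁺ (p⊆q y∈p) y≢x

module Walks (G : Graph) where

  E : V G → V G → Set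
  E = Edge G

  E-sym : ∀ {u v} → E u v → E v u
  E-sym {u} {v} e = trans (Graph.sym G v u) e

  E-irrefl : ∀ {u} → ¬ E u u
  E-irrefl {u} e with trans (sym e) (irrefl G u)
  ... | ()

  E⇒≢ : ∀ {u v} → E u v → u ≢ v
  E⇒≢ e refl = E-irrefl e

  E? : ∀ u v → Dec (E u v)
  E? u v = adj G u v ≟ᵇ true

  ClosedAdj : V G → V G → Set
  ClosedAdj u v = u ≡ v ⊎ E u v

  ClosedAdj-sym : ∀ {u v} → ClosedAdj u v → ClosedAdj v u
  ClosedAdj-sym (inj₁ u≡v) = inj₁ (sym u≡v)
  ClosedAdj-sym (inj₂ e)   = inj₂ (E-sym e)

  ClosedAdj? : ∀ u v → Dec (ClosedAdj u v)
  ClosedAdj? u v with u ≟ v | E? u v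
  ... | yes u≡v | _     = yes (inj₁ u≡v)
  ... | no  _   | yes e = yes (inj₂ e)
  ... | no  u≢v | no ¬e = no λ { (inj₁ u≡v) → u≢v u≡v ; (inj₂ e) → ¬e e }

  Path : Subset (n G) → V G → V G → Set
  Path = PathIn G

  private variable
    S T : Subset (n G)
    a b c r u v w z : V G
    vs : List (V G)

  Path-head∈ : Path S u v → u ∈ S
  Path-head∈ (here u∈) = u∈
  Path-head∈ (step u∈ _ _) = u∈

  Path-last∈ : Path S u v → v ∈ S
  Path-last∈ (here v∈) = v∈
  Path-last∈ (step _ _ p) = Path-last∈ p

  Path-mono : S ⊆ T → Path S u v → Path T u v
  Path-mono S⊆T (here u∈) = here (S⊆T u∈)
  Path-mono S⊆T (step u∈ e p) = step (S⊆T u∈) e (Path-mono S⊆T p)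

  infixr 5 _++ᴾ_
  _++ᴾ_ : Path S u v → Path S v w → Path S u w
  here _ ++ᴾ q = q
  step u∈ e p ++ᴾ q = step u∈ e (p ++ᴾ q)

  Path-edge : u ∈ S → v ∈ S → E u v → Path S u v
  Path-edge u∈ v∈ e = step u∈ e (here v∈)

  Path-reverse : Path S u v → Path S v u
  Path-reverse (here u∈) = here u∈
  Path-reverse (step u∈ e p) = Path-reverse p ++ᴾ Path-edge (Path-head∈ p) u∈ (E-sym e)

  hub⇒Connected : (∀ u → u ∈ S → Path S u w) → Connected G S
  hub⇒Connected to-hub u v u∈ v∈ = to-hub u u∈ ++ᴾ Path-reverse (to-hub v v∈)

  -- Walk a b vs: a walk from a to b whose vertices after a are, in order, vs
  infixr 5 _∷ʷ_
  data Walk : V G → V G → List (V G) → Set where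
    stay : Walk a a []
    _∷ʷ_ : E a c → Walk c b vs → Walk a b (c ∷ vs)

  Walk-last∈ : Walk a b vs → b ∈ˡ a ∷ vs
  Walk-last∈ stay = here refl
  Walk-last∈ (_ ∷ʷ w) = there (Walk-last∈ w)

  Walk⇒Path-from-head : Walk a b vs → All (_∈ T) (a ∷ vs) → u ∈ˡ a ∷ vs → Path T a u
  Walk⇒Path-from-head w (a∈ ∷ _) (here refl) = here a∈
  Walk⇒Path-from-head (e ∷ʷ w) (a∈ ∷ vs∈) (there u∈) = step a∈ e (Walk⇒Path-from-head w vs∈ u∈)

  Walk⇒Path-to-head : Walk a b vs → All (_∈ T) (a ∷ vs) → u ∈ˡ a ∷ vs → Path T u a
  Walk⇒Path-to-head w vs∈ u∈ = Path-reverse (Walk⇒Path-from-head w vs∈ u∈)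

  Walk⇒Path-to-last : Walk a b vs → All (_∈ T) (a ∷ vs) → u ∈ˡ a ∷ vs → Path T u b
  Walk⇒Path-to-last stay (a∈ ∷ []) (here refl) = here a∈
  Walk⇒Path-to-last (e ∷ʷ w) (a∈ ∷ vs∈) (here refl) = step a∈ e (Walk⇒Path-to-last w vs∈ (here refl))
  Walk⇒Path-to-last (_ ∷ʷ w) (_ ∷ vs∈) (there u∈) = Walk⇒Path-to-last w vs∈ u∈

  Walk-suffix : ∀ xs {y ys} → Walk a b (xs ++ y ∷ ys) → Walk y b ys
  Walk-suffix []       (_ ∷ʷ w) = w
  Walk-suffix (_ ∷ xs) (_ ∷ʷ w) = Walk-suffix xs w

  Walk-prefix : ∀ xs {y ys} → Walk a b (xs ++ y ∷ ys) → Walk a y (xs ++ y ∷ [])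
  Walk-prefix []       (e ∷ʷ _) = e ∷ʷ stay
  Walk-prefix (_ ∷ xs) (e ∷ʷ w) = e ∷ʷ Walk-prefix xs w

  Walk-avoid : Walk a b vs → Unique (a ∷ vs) → All (_∈ T) (a ∷ vs) → u ∈ˡ a ∷ vs → u ≢ r →
               Path (T - r) u a ⊎ Path (T - r) u b
  Walk-avoid _ _ (a∈ ∷ _) (here refl) u≢r = inj₁ (here (x∈p-y⁺ a∈ u≢r))
  Walk-avoid {a = a} {r = r} (e ∷ʷ w) (a∉ ∷ vs!) (a∈ ∷ vs∈) (there u∈) u≢r with a ≟ r
  ... | yes refl =
        inj₂ (Walk⇒Path-to-last w (All.zipWith (λ (v∈ , a≢v) → x∈p-y⁺ v∈ (a≢v ∘ sym)) (vs∈ , a∉)) u∈)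
  ... | no a≢r with Walk-avoid w vs! vs∈ u∈ u≢r
  ...   | inj₂ p = inj₂ p
  ...   | inj₁ p = inj₁ (p ++ᴾ Path-edge (Path-last∈ p) (x∈p-y⁺ a∈ a≢r) (E-sym e))

  loop-erase : Path S u v → ∃[ vs ] (Walk u v vs × Unique (u ∷ vs) × All (_∈ S) (u ∷ vs))
  loop-erase (here u∈) = [] , stay , [] ∷ [] , u∈ ∷ []
  loop-erase {u = u} (step u∈ e p) with loop-erase p
  ... | vs , w , vs! , vs∈ with Any.any? (u ≟_) (_ ∷ vs)
  ...   | no u∉ = _ , e ∷ʷ w , ¬Any⇒All¬ _ u∉ ∷ vs! , u∈ ∷ vs∈
  ...   | yes (here refl) = contradiction refl (E⇒≢ e)
  ...   | yes (there u∈vs) with ∈-∃++ u∈vs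
  ...     | xs , ys , refl = ys , Walk-suffix xs w , Unique-++⁻ʳ (_ ∷ xs) vs! , ++⁻ʳ (_ ∷ xs) vs∈

  Walk-first-entry : ∀ {B L x} → Walk z x L → z ∉ B → x ∈ B →
    ∃[ y ] ∃[ as ] ∃[ b ] ∃[ rest ]
      (Walk z y as × E y b × b ∈ B × All (_∉ B) (z ∷ as) × L ≡ as ++ b ∷ rest)
  Walk-first-entry stay z∉ x∈ = contradiction x∈ z∉
  Walk-first-entry {z = z} {B = B} (_∷ʷ_ {c = c} e w) z∉ x∈ with c ∈? B
  ... | yes c∈ = z , [] , c , _ , stay , e , c∈ , z∉ ∷ [] , refl
  ... | no c∉ with Walk-first-entry w c∉ x∈
  ...   | y , as , b , rest , w′ , e′ , b∈ , as∉ , refl =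
          y , c ∷ as , b , rest , e ∷ʷ w′ , e′ , b∈ , z∉ ∷ as∉ , refl

  _▹_ : Path S u v → v ∈ S × w ∈ S × E v w → Path S u w
  p ▹ (v∈ , w∈ , e) = p ++ᴾ Path-edge v∈ w∈ e

  biconnected-∪-ear : ∀ {B} → Biconnected G B → w ∈ B → b ∈ B → w ≢ b →
    E w a → Walk a z vs → E z b → Unique (a ∷ vs) → All (_∉ B) (a ∷ vs) →
    Biconnected G (B ∪ fromList (a ∷ vs))
  biconnected-∪-ear {w} {b} {a} {z} {vs} {B} (_ , B-conn , B-del) w∈ b∈ w≢b wa ear zb ear! ear∉ =
    (w , b , inB w∈ , inB b∈ , w≢b) , hub⇒Connected to-w , deleted
    where
    B⁺ : Subset (n G)
    B⁺ = B ∪ fromList (a ∷ vs)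

    inB : B ⊆ B⁺
    inB = x∈p∪q⁺ ∘ inj₁

    ear∈ : All (_∈ B⁺) (a ∷ vs)
    ear∈ = All.tabulate (x∈p∪q⁺ ∘ inj₂ ∘ ∈-fromList⁺ (a ∷ vs))

    split : ∀ {u} → u ∈ B⁺ → u ∈ B ⊎ u ∈ˡ a ∷ vs
    split u∈ = map₂ (∈-fromList⁻ _) (x∈p∪q⁻ B _ u∈)

    to-w : ∀ u → u ∈ B⁺ → Path B⁺ u w
    to-w u u∈ with split u∈
    ... | inj₁ u∈B = Path-mono inB (B-conn u w u∈B w∈)
    ... | inj₂ u∈ear = Walk⇒Path-to-head ear ear∈ u∈ear ▹ (All.head ear∈ , inB w∈ , E-sym wa)

    ear-r : ∀ {r} → r ∈ B → All (_∈ B⁺ - r) (a ∷ vs)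
    ear-r r∈B = All.zipWith (λ (v∈ , v∉B) → x∈p-y⁺ v∈ λ { refl → v∉B r∈B }) (ear∈ , ear∉)

    around-B : ∀ {r c} → r ∈ B → c ∈ B - r → (∀ {u} → u ∈ˡ a ∷ vs → Path (B⁺ - r) u c) →
               Connected G (B⁺ - r)
    around-B {r} {c} r∈B c∈ ear-to-c = hub⇒Connected to-c
      where
      to-c : ∀ u → u ∈ B⁺ - r → Path (B⁺ - r) u c
      to-c u u∈ with x∈p-y⁻ u∈
      ... | u∈B⁺ , u≢r with split u∈B⁺
      ...   | inj₁ u∈B = Path-mono (p⊆q⇒p-x⊆q-x inB) (B-del r r∈B u c (x∈p-y⁺ u∈B u≢r) c∈)
      ...   | inj₂ u∈ear = ear-to-c u∈ear

    deleted : ∀ r → r ∈ B⁺ → Connected G (B⁺ - r)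
    deleted r _ with r ∈? B | w ≟ r
    ... | yes r∈B | no w≢r = around-B r∈B w∈B-r λ u∈ →
          Walk⇒Path-to-head ear (ear-r r∈B) u∈ ▹ (All.head (ear-r r∈B) , p⊆q⇒p-x⊆q-x inB w∈B-r , E-sym wa)
      where
      w∈B-r : w ∈ B - r
      w∈B-r = x∈p-y⁺ w∈ w≢r
    ... | yes r∈B | yes refl = around-B r∈B b∈B-r λ u∈ →
          Walk⇒Path-to-last ear (ear-r r∈B) u∈
            ▹ (All.lookup (ear-r r∈B) (Walk-last∈ ear) , p⊆q⇒p-x⊆q-x inB b∈B-r , zb)
      where
      b∈B-r : b ∈ B - r
      b∈B-r = x∈p-y⁺ b∈ (w≢b ∘ sym)
    ... | no r∉B | _ = hub⇒Connected to-w′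
      where
      B⊆B⁺-r : B ⊆ B⁺ - r
      B⊆B⁺-r v∈B = x∈p-y⁺ (inB v∈B) λ { refl → r∉B v∈B }

      to-w′ : ∀ u → u ∈ B⁺ - r → Path (B⁺ - r) u w
      to-w′ u u∈ with x∈p-y⁻ u∈
      ... | u∈B⁺ , u≢r with split u∈B⁺
      ...   | inj₁ u∈B = Path-mono B⊆B⁺-r (B-conn u w u∈B w∈)
      ...   | inj₂ u∈ear with Walk-avoid ear ear! ear∈ u∈ear u≢r
      ...     | inj₁ p = p ▹ (Path-last∈ p , B⊆B⁺-r w∈ , E-sym wa)
      ...     | inj₂ p = p ▹ (Path-last∈ p , B⊆B⁺-r b∈ , zb) ++ᴾ Path-mono B⊆B⁺-r (B-conn b w b∈ w∈)

  biconnected-edge : E a b → Biconnected G (fromList (a ∷ b ∷ []))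
  biconnected-edge {a} {b} e = (a , b , a∈ , b∈ , E⇒≢ e) , hub⇒Connected to-a , deleted
    where
    a∈ : a ∈ fromList (a ∷ b ∷ [])
    a∈ = ∈-fromList⁺ (a ∷ b ∷ []) (here refl)

    b∈ : b ∈ fromList (a ∷ b ∷ [])
    b∈ = ∈-fromList⁺ (a ∷ b ∷ []) (there (here refl))

    cases : ∀ {x} → x ∈ fromList (a ∷ b ∷ []) → x ≡ a ⊎ x ≡ b
    cases x∈ with ∈-fromList⁻ (a ∷ b ∷ []) x∈
    ... | here refl         = inj₁ refl
    ... | there (here refl) = inj₂ refl

    to-a : ∀ u → u ∈ fromList (a ∷ b ∷ []) → Path (fromList (a ∷ b ∷ [])) u a
    to-a u u∈ with cases u∈
    ... | inj₁ refl = here a∈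
    ... | inj₂ refl = Path-edge b∈ a∈ (E-sym e)

    deleted : ∀ r → r ∈ fromList (a ∷ b ∷ []) → Connected G (fromList (a ∷ b ∷ []) - r)
    deleted r _ u v u∈ v∈ with cases (proj₁ (x∈p-y⁻ u∈)) | cases (proj₁ (x∈p-y⁻ v∈))
    ... | inj₁ refl | inj₁ refl = here u∈
    ... | inj₂ refl | inj₂ refl = here u∈
    ... | inj₁ refl | inj₂ refl = Path-edge u∈ v∈ e
    ... | inj₂ refl | inj₁ refl = Path-edge u∈ v∈ (E-sym e)

  -- the cycle h a c … y h, as the edge ha plus the ear c … y
  biconnected-cycle : ∀ {h y} → Walk h y (a ∷ c ∷ vs) → E y h → Unique (h ∷ a ∷ c ∷ vs) →
    Biconnected G (fromList (h ∷ a ∷ c ∷ vs))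
  biconnected-cycle {a} {c} {vs} {h} (ha ∷ʷ ac ∷ʷ w) yh ((_ ∷ h∉) ∷ a∉ ∷ ear!) =
    subst (Biconnected G) (sym (fromList-++ (h ∷ a ∷ []) (c ∷ vs)))
      (biconnected-∪-ear (biconnected-edge ha) (∈-fromList⁺ (h ∷ a ∷ []) (there (here refl)))
         (∈-fromList⁺ (h ∷ a ∷ []) (here refl))
         (E⇒≢ (E-sym ha)) ac w yh ear! (All.zipWith off-edge (h∉ , a∉)))
    where
    off-edge : ∀ {v} → h ≢ v × a ≢ v → v ∉ fromList (h ∷ a ∷ [])
    off-edge (h≢v , a≢v) v∈ with ∈-fromList⁻ (h ∷ a ∷ []) v∈
    ... | here refl         = h≢v refl
    ... | there (here refl) = a≢v refl

  other-vertex : ∀ {B} → Biconnected G B → ∀ w → ∃[ x ] (x ∈ B × x ≢ w)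
  other-vertex ((p , q , p∈ , q∈ , p≢q) , _) w with p ≟ w
  ... | yes refl = q , q∈ , p≢q ∘ sym
  ... | no  p≢w  = p , p∈ , p≢w

  first-step : Path S u v → u ≢ v → ∃[ c ] (c ∈ S × E u c)
  first-step (here _)       u≢u = contradiction refl u≢u
  first-step (step _ e p) _   = _ , Path-head∈ p , e

  -- Otherwise a shortest detour from z back to B avoiding w would be an ear, contradicting maximality.
  Block⇒CutVertex : ∀ {Y B} → Block G Y B → w ∈ B → z ∈ Y → z ∉ B → E w z → CutVertex G Y w
  Block⇒CutVertex {w} {z} {Y} {B} (B⊆Y , B-bic , B-max) w∈ z∈ z∉ wz with other-vertex B-bic w
  ... | x , x∈ , x≢w =
    B⊆Y w∈ , z , x , x∈p-y⁺ z∈ (E⇒≢ wz ∘ sym) , x∈p-y⁺ (B⊆Y x∈) x≢w ,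
    step z∈ (E-sym wz) (Path-mono B⊆Y (proj₁ (proj₂ B-bic) w x w∈ x∈)) , no-detour
    where
    no-detour : ¬ Path (Y - w) z x
    no-detour p with loop-erase p
    ... | L , walk , L! , L∈ with Walk-first-entry walk z∉ x∈
    ...   | y , as , b , rest , ear , yb , b∈ , ear∉ , refl =
            z∉ (subst (z ∈_) (B-max B⁺ (x∈p∪q⁺ ∘ inj₁) B⁺⊆Y B⁺-bic) z∈B⁺)
      where
      B⁺ : Subset (n G)
      B⁺ = B ∪ fromList (z ∷ as)

      z∈B⁺ : z ∈ B⁺
      z∈B⁺ = x∈p∪q⁺ (inj₂ (∈-fromList⁺ (z ∷ as) (here refl)))

      w≢b : w ≢ b
      w≢b = proj₂ (x∈p-y⁻ (All.head (++⁻ʳ (z ∷ as) L∈))) ∘ sym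

      B⁺-bic : Biconnected G B⁺
      B⁺-bic = biconnected-∪-ear B-bic w∈ b∈ w≢b wz ear yb (Unique-++⁻ˡ (z ∷ as) L!) ear∉

      B⁺⊆Y : B⁺ ⊆ Y
      B⁺⊆Y v∈ with x∈p∪q⁻ B (fromList (z ∷ as)) v∈
      ... | inj₁ v∈B   = B⊆Y v∈B
      ... | inj₂ v∈ear =
            proj₁ (x∈p-y⁻ (All.lookup (++⁻ˡ (z ∷ as) L∈) (∈-fromList⁻ (z ∷ as) v∈ear)))

module BlockCutForest (G : Graph) (Y : Subset (n G)) where

  private variable
    a c d : Node G
    vs : List (Node G)

  BCWalk-head : BCWalk G Y a c vs → ∃[ t ] vs ≡ c ∷ t
  BCWalk-head start      = [] , refl
  BCWalk-head (extend _ _) = _ , refl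

  BCWalk-cut : BCWalk G Y a c vs → d ∈ˡ vs → ∃[ pre ] ∃[ t ] (vs ≡ pre ++ d ∷ t × BCWalk G Y a d (d ∷ t))
  BCWalk-cut start        (here refl) = [] , [] , refl , start
  BCWalk-cut (extend W e) (here refl) = [] , _ , refl , extend W e
  BCWalk-cut (extend {c = c} W _) (there d∈) with BCWalk-cut W d∈
  ... | pre , t , refl , W′ = c ∷ pre , t , refl , W′

  cv≟ : ∀ w (N : Node G) → Dec (cv w ≡ N)
  cv≟ w (cv x) with w ≟ x
  ... | yes refl = yes refl
  ... | no  w≢x  = no λ { refl → w≢x refl }
  cv≟ w (bl _) = no λ ()

module LeafChildren (G : Graph) (Y : Subset (n G)) (root : V G → V G) where
  open Walks G
  open BlockCutForest G Y

  LeafChild : V G → Subset (n G) → Set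
  LeafChild x B = Child G Y root (cv x) (bl B) × LeafBlock G Y root B

  private variable
    B B₁ B₂ : Subset (n G)
    u v w x y z : V G

  LeafChild⇒Block : LeafChild x B → Block G Y B
  LeafChild⇒Block (_ , B-block , _) = B-block

  LeafChild⇒∈ : LeafChild x B → x ∈ B
  LeafChild⇒∈ ((_ , _ , _ , _ , _ , _ , _ , x∈B) , _) = x∈B

  -- If cv w were not on the root path of x, it would be a child of B; if it were, cv x would be.
  cutvertex∈leaf⇒parent : LeafChild x B → w ∈ B → CutVertex G Y w → w ≡ x
  cutvertex∈leaf⇒parent {x} {B} {w} ((r , r-root , vs , W , B∉ ∷ vs! , x-B) , B-block , childless) w∈B w-cut
    with w ≟ x
  ... | yes w≡x = w≡x
  ... | no  w≢x with Any.any? (cv≟ w) vs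
  ...   | no w∉vs = contradiction
            (r , (x , proj₂ (proj₂ x-B) , r-root) , bl B ∷ vs , extend W x-B ,
             ((λ ()) ∷ ¬Any⇒All¬ vs w∉vs) ∷ B∉ ∷ vs! , w-cut , B-block , w∈B)
            (childless (cv w))
  ...   | yes w∈vs with BCWalk-cut W w∈vs | BCWalk-head W
  ...     | []        , t , refl , _  | _ , refl = contradiction refl w≢x
  ...     | (_ ∷ pre) , t , refl , W′ | _ , refl with B∉ | vs!
  ...       | _ ∷ B∉′ | x∉ ∷ rest! = contradiction
              (r , (x , proj₂ (proj₂ x-B) , r-root) , bl B ∷ cv w ∷ t , extend W′ (w-cut , B-block , w∈B) ,
               ((λ ()) ∷ ++⁻ʳ pre x∉) ∷ ++⁻ʳ pre B∉′ ∷ Unique-++⁻ʳ pre rest! , x-B)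
              (childless (cv x))

  leaf-closed : LeafChild x B → w ∈ B → w ≢ x → z ∈ Y → ClosedAdj w z → z ∈ B
  leaf-closed _ w∈B _ _ (inj₁ refl) = w∈B
  leaf-closed {B = B} {z = z} leaf w∈B w≢x z∈Y (inj₂ wz) with z ∈? B
  ... | yes z∈B = z∈B
  ... | no  z∉B = contradiction
        (cutvertex∈leaf⇒parent leaf w∈B (Block⇒CutVertex (LeafChild⇒Block leaf) w∈B z∈Y z∉B wz)) w≢x

  Path-stays-in-leaf : LeafChild x B → Path (Y - x) u v → u ∈ B → v ∈ B
  Path-stays-in-leaf _ (here _) u∈B = u∈B
  Path-stays-in-leaf leaf (step u∈ e p) u∈B with x∈p-y⁻ u∈ | x∈p-y⁻ (Path-head∈ p)
  ... | _ , u≢x | w∈Y , _ = Path-stays-in-leaf leaf p (leaf-closed leaf u∈B u≢x w∈Y (inj₂ e))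

  leaf-children-⊆ : LeafChild x B₁ → LeafChild x B₂ → v ∈ B₁ → v ∈ B₂ → v ≢ x → B₂ ⊆ B₁
  leaf-children-⊆ {x} leaf₁ leaf₂ v∈₁ v∈₂ v≢x {q} q∈₂ with q ≟ x | LeafChild⇒Block leaf₂
  ... | yes refl | _ = LeafChild⇒∈ leaf₁
  ... | no  q≢x  | B₂⊆Y , (_ , _ , B₂-del) , _ = Path-stays-in-leaf leaf₁
        (Path-mono (p⊆q⇒p-x⊆q-x B₂⊆Y)
          (B₂-del x (LeafChild⇒∈ leaf₂) _ q (x∈p-y⁺ v∈₂ v≢x) (x∈p-y⁺ q∈₂ q≢x)))
        v∈₁

  leaf-children-≡ : LeafChild x B₁ → LeafChild x B₂ → v ∈ B₁ → v ∈ B₂ → v ≢ x → B₁ ≡ B₂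
  leaf-children-≡ leaf₁ leaf₂ v∈₁ v∈₂ v≢x =
    ⊆-antisym (leaf-children-⊆ leaf₂ leaf₁ v∈₂ v∈₁ v≢x) (leaf-children-⊆ leaf₁ leaf₂ v∈₁ v∈₂ v≢x)

  record Arm (x : V G) (B : Subset (n G)) : Set where
    field
      leaf : LeafChild x B
      tip  : V G
      tip∈ : tip ∈ B
      tip≢ : tip ≢ x
      edge : E x tip

    tip∈Y : tip ∈ Y
    tip∈Y = proj₁ (LeafChild⇒Block leaf) tip∈

  open Arm

  arm : LeafChild x B → Arm x B
  arm {x} leaf with LeafChild⇒Block leaf
  ... | _ , B-bic , _ with other-vertex B-bic x
  ...   | y , y∈ , y≢x with first-step (proj₁ (proj₂ B-bic) x y (LeafChild⇒∈ leaf) y∈) (y≢x ∘ sym)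
  ...     | t , t∈ , xt = record { leaf = leaf ; tip = t ; tip∈ = t∈ ; tip≢ = E⇒≢ xt ∘ sym ; edge = xt }

  -- the induced path tip₁ – x – tip₂ through two distinct leaf children of x
  record Cherry (x : V G) : Set where
    field
      cut   : CutVertex G Y x
      block₁ block₂ : Subset (n G)
      distinct      : block₁ ≢ block₂
      arm₁          : Arm x block₁
      arm₂          : Arm x block₂

  open Cherry

  Type1⇒Cherry : Type1 G Y root x → Cherry x
  Type1⇒Cherry (x-cut , B₁ , B₂ , B₁≢B₂ , child₁ , leaf₁ , child₂ , leaf₂) =
    record { cut = x-cut ; block₁ = B₁ ; block₂ = B₂ ; distinct = B₁≢B₂
           ; arm₁ = arm (child₁ , leaf₁) ; arm₂ = arm (child₂ , leaf₂) }

  cherry-vertex : Cherry x → Fin 3 → V G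
  cherry-vertex χ zero             = tip (arm₁ χ)
  cherry-vertex {x} χ (suc zero)   = x
  cherry-vertex χ (suc (suc zero)) = tip (arm₂ χ)

  arms-apart : (α : Arm x B₁) (β : Arm x B₂) → B₁ ≢ B₂ → ¬ ClosedAdj (tip α) (tip β)
  arms-apart α β B₁≢B₂ tα~tβ = B₁≢B₂ (leaf-children-≡ (leaf α) (leaf β)
    (leaf-closed (leaf α) (tip∈ α) (tip≢ α) (tip∈Y β) tα~tβ) (tip∈ β) (tip≢ β))

  cutvertex-apart-arm : CutVertex G Y y → y ≢ x → (α : Arm x B) → ¬ ClosedAdj y (tip α)
  cutvertex-apart-arm y-cut y≢x α y~t = y≢x (cutvertex∈leaf⇒parent (leaf α)
    (leaf-closed (leaf α) (tip∈ α) (tip≢ α) (proj₁ y-cut) (ClosedAdj-sym y~t)) y-cut)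

  arms-of-distinct-apart : CutVertex G Y x → CutVertex G Y y → x ≢ y →
    (α : Arm x B₁) (β : Arm y B₂) → ¬ ClosedAdj (tip α) (tip β)
  arms-of-distinct-apart {x} {y} {B₁} x-cut y-cut x≢y α β tα~tβ =
    x≢y (sym (cutvertex∈leaf⇒parent (leaf α) y∈B₁ y-cut))
    where
    tβ∈B₁ : tip β ∈ B₁
    tβ∈B₁ = leaf-closed (leaf α) (tip∈ α) (tip≢ α) (tip∈Y β) tα~tβ
    tβ≢x : tip β ≢ x
    tβ≢x tβ≡x = cutvertex-apart-arm x-cut x≢y β (inj₁ (sym tβ≡x))
    y∈B₁ : y ∈ B₁
    y∈B₁ = leaf-closed (leaf α) tβ∈B₁ tβ≢x (proj₁ y-cut) (inj₂ (E-sym (edge β)))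

  cherry-edge : (χ : Cherry x) → ∀ a b → P3adj a b → E (cherry-vertex χ a) (cherry-vertex χ b)
  cherry-edge χ zero             (suc zero)       _ = E-sym (edge (arm₁ χ))
  cherry-edge χ (suc zero)       zero             _ = edge (arm₁ χ)
  cherry-edge χ (suc zero)       (suc (suc zero)) _ = edge (arm₂ χ)
  cherry-edge χ (suc (suc zero)) (suc zero)       _ = E-sym (edge (arm₂ χ))

  cherry-touch : (χ : Cherry x) → ∀ a b →
    ClosedAdj (cherry-vertex χ a) (cherry-vertex χ b) → a ≡ b ⊎ P3adj a b
  cherry-touch χ zero             zero             _ = inj₁ refl
  cherry-touch χ zero             (suc zero)       _ = inj₂ tt
  cherry-touch χ zero             (suc (suc zero)) t = ⊥-elim (arms-apart (arm₁ χ) (arm₂ χ) (distinct χ) t)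
  cherry-touch χ (suc zero)       zero             _ = inj₂ tt
  cherry-touch χ (suc zero)       (suc zero)       _ = inj₁ refl
  cherry-touch χ (suc zero)       (suc (suc zero)) _ = inj₂ tt
  cherry-touch χ (suc (suc zero)) zero             t =
    ⊥-elim (arms-apart (arm₁ χ) (arm₂ χ) (distinct χ) (ClosedAdj-sym t))
  cherry-touch χ (suc (suc zero)) (suc zero)       _ = inj₂ tt
  cherry-touch χ (suc (suc zero)) (suc (suc zero)) _ = inj₁ refl

  cherries-apart : (χ : Cherry x) (ψ : Cherry y) → ¬ ClosedAdj x y →
    ∀ a b → ¬ ClosedAdj (cherry-vertex χ a) (cherry-vertex ψ b)
  cherries-apart {x} {y} χ ψ x≁y = apart
    where
    x≢y : x ≢ y
    x≢y = x≁y ∘ inj₁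

    y≢x : y ≢ x
    y≢x = x≢y ∘ sym

    apart : ∀ a b → ¬ ClosedAdj (cherry-vertex χ a) (cherry-vertex ψ b)
    apart (suc zero)       (suc zero)       = x≁y
    apart (suc zero)       zero             = cutvertex-apart-arm (cut χ) x≢y (arm₁ ψ)
    apart (suc zero)       (suc (suc zero)) = cutvertex-apart-arm (cut χ) x≢y (arm₂ ψ)
    apart zero             (suc zero)       = cutvertex-apart-arm (cut ψ) y≢x (arm₁ χ) ∘ ClosedAdj-sym
    apart (suc (suc zero)) (suc zero)       = cutvertex-apart-arm (cut ψ) y≢x (arm₂ χ) ∘ ClosedAdj-sym
    apart zero             zero             = arms-of-distinct-apart (cut χ) (cut ψ) x≢y (arm₁ χ) (arm₁ ψ)
    apart zero             (suc (suc zero)) = arms-of-distinct-apart (cut χ) (cut ψ) x≢y (arm₁ χ) (arm₂ ψ)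
    apart (suc (suc zero)) zero             = arms-of-distinct-apart (cut χ) (cut ψ) x≢y (arm₂ χ) (arm₁ ψ)
    apart (suc (suc zero)) (suc (suc zero)) = arms-of-distinct-apart (cut χ) (cut ψ) x≢y (arm₂ χ) (arm₂ ψ)

  cherries⇒¬sP3Free : ∀ {s} (g : Fin s → V G) → (∀ i → Cherry (g i)) →
    (∀ i j → i ≢ j → ¬ ClosedAdj (g i) (g j)) → ¬ sP3Free s G
  cherries⇒¬sP3Free {s} g χ apart free = free (f , f-injective , f-edges)
    where
    f : Fin s × Fin 3 → V G
    f (i , a) = cherry-vertex (χ i) a

    touch : ∀ i j a b → ClosedAdj (f (i , a)) (f (j , b)) → i ≡ j × (a ≡ b ⊎ P3adj a b)
    touch i j a b t with i ≟ j
    ... | yes refl = refl , cherry-touch (χ i) a b t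
    ... | no  i≢j  = ⊥-elim (cherries-apart (χ i) (χ j) (apart i j i≢j) a b t)

    f-injective : Injective _≡_ _≡_ f
    f-injective {i , a} {j , b} eq with touch i j a b (inj₁ eq)
    ... | refl , inj₁ refl = refl
    ... | refl , inj₂ ab   = ⊥-elim (E-irrefl (subst (λ v → E v (f (i , b))) eq (cherry-edge (χ i) a b ab)))

    f-edges : ∀ p q → Edge G (f p) (f q) ⇔ sP3adj s p q
    f-edges (i , a) (j , b) = mk⇔ to from
      where
      to : Edge G (f (i , a)) (f (j , b)) → i ≡ j × P3adj a b
      to e with touch i j a b (inj₂ e)
      ... | refl , inj₁ refl = ⊥-elim (E-irrefl e)
      ... | refl , inj₂ ab   = refl , ab

      from : i ≡ j × P3adj a b → Edge G (f (i , a)) (f (j , b))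
      from (refl , ab) = cherry-edge (χ i) a b ab

Any⇒order≤maxOrder : ∀ {P : Graph → Set} C → Any P C → ∃[ H ] (P H × n H ≤ maxOrder C)
Any⇒order≤maxOrder (H ∷ C) (here pH) = H , pH , m≤m⊔n (n H) _
Any⇒order≤maxOrder (H ∷ C) (there pC) with Any⇒order≤maxOrder C pC
... | H′ , pH′ , H′≤max = H′ , pH′ , ≤-trans H′≤max (m≤n⊔m (n H) _)

IsoTo⇒length≤ : ∀ G {H B L} → IsoTo G H B → Unique L → All (_∈ B) L → length L ≤ n H
IsoTo⇒length≤ G {H} {L = L} (f , _ , _ , onto , _) L! L∈B = begin
  length L                      ≤⟨ Unique⇒length≤ L! L⊆image ⟩
  length (map f (allFin (n H))) ≡⟨ length-map f (allFin (n H)) ⟩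
  length (allFin (n H))         ≡⟨ length-tabulate id ⟩
  n H                           ∎
  where
  open ≤-Reasoning
  L⊆image : L ⊆ˡ map f (allFin (n H))
  L⊆image y∈L with onto _ (All.lookup L∈B y∈L)
  ... | i , refl = ∈-map⁺ f (∈-allFin i)

module BlockGraphs (G : Graph) (C : List Graph) (X : Subset (n G)) (C-blocks : BlockGraph G C X) where
  open Walks G

  private variable
    B S : Subset (n G)
    a c h y : V G
    L vs : List (V G)

  d : ℕ
  d = maxOrder C

  block-length≤ : Block G X B → Unique L → All (_∈ B) L → length L ≤ d
  block-length≤ {B} B-block L! L∈B with Any⇒order≤maxOrder {P = λ H → IsoTo G H B} C (C-blocks B B-block)
  ... | H , iso , H≤d = ≤-trans (IsoTo⇒length≤ G {H} {B} iso L! L∈B) H≤d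

  -- Only doubly negated: constructively we cannot decide when a biconnected superset is maximal.
  Biconnected⇒¬¬⊆Block : S ⊆ X → Biconnected G S → ¬ (∀ B → Block G X B → ¬ S ⊆ B)
  Biconnected⇒¬¬⊆Block {S} S⊆X S-bic no-block = grow S (⊃-wellFounded S) (λ x∈ → x∈) S⊆X S-bic
    where
    grow : ∀ T → Acc _⊃_ T → S ⊆ T → T ⊆ X → Biconnected G T → ⊥
    grow T (acc larger) S⊆T T⊆X T-bic = no-block T (T⊆X , T-bic , maximal) S⊆T
      where
      maximal : ∀ T′ → T ⊆ T′ → T′ ⊆ X → Biconnected G T′ → T′ ≡ T
      maximal T′ T⊆T′ T′⊆X T′-bic with ⊆⇒≡⊎⊂ T⊆T′
      ... | inj₁ T′≡T = T′≡T
      ... | inj₂ T⊂T′ = ⊥-elim (grow T′ (larger T⊂T′) (λ x∈ → T⊆T′ (S⊆T x∈)) T′⊆X T′-bic)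

  Biconnected⇒length≤ : S ⊆ X → Biconnected G S → Unique L → All (_∈ S) L → length L ≤ d
  Biconnected⇒length≤ {L = L} S⊆X S-bic L! L∈S with length L ≤? d
  ... | yes L≤d = L≤d
  ... | no  L≰d = ⊥-elim (Biconnected⇒¬¬⊆Block S⊆X S-bic λ _ B-block S⊆B →
                    L≰d (block-length≤ B-block L! (All.map S⊆B L∈S)))

  Biconnected⇒2≤d : S ⊆ X → Biconnected G S → 2 ≤ d
  Biconnected⇒2≤d S⊆X S-bic@((u , v , u∈ , v∈ , u≢v) , _) =
    Biconnected⇒length≤ S⊆X S-bic ((u≢v ∷ []) ∷ [] ∷ []) (u∈ ∷ v∈ ∷ [])

  cycle-length≤ : Walk h y (a ∷ c ∷ vs) → E y h → Unique (h ∷ a ∷ c ∷ vs) → All (_∈ X) (h ∷ a ∷ c ∷ vs) →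
    length (h ∷ a ∷ c ∷ vs) ≤ d
  cycle-length≤ {h} {a = a} {c} {vs} W yh W! W⊆X =
    Biconnected⇒length≤ cycle⊆X (biconnected-cycle W yh W!) W! (All.tabulate (∈-fromList⁺ (h ∷ a ∷ c ∷ vs)))
    where
    cycle⊆X : fromList (h ∷ a ∷ c ∷ vs) ⊆ X
    cycle⊆X v∈ = All.lookup W⊆X (∈-fromList⁻ (h ∷ a ∷ c ∷ vs) v∈)

  closed-walk-length≤ : 2 ≤ d → ∀ xs → Walk h y (xs ++ y ∷ []) → E y h →
    Unique (h ∷ xs ++ y ∷ []) → All (_∈ X) (h ∷ xs ++ y ∷ []) → length (h ∷ xs ++ y ∷ []) ≤ d
  closed-walk-length≤ 2≤d []           _ _  _  _   = 2≤d
  closed-walk-length≤ _   (_ ∷ [])     W yh W! W⊆X = cycle-length≤ W yh W! W⊆X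
  closed-walk-length≤ _   (_ ∷ _ ∷ _)  W yh W! W⊆X = cycle-length≤ W yh W! W⊆X

  record MaximalWalk (R : List (V G)) : Set where
    constructor maximal
    field
      head last : V G
      rest      : List (V G)
      walk      : Walk head last rest
      unique    : Unique (head ∷ rest)
      ⊆R        : head ∷ rest ⊆ˡ R
      saturated : ∀ {z} → z ∈ˡ R → E head z → z ∈ˡ rest

  maximal-walk : ∀ {R v} → v ∈ˡ R → MaximalWalk R
  maximal-walk {R} {v} v∈R = grow (length R) stay ([] ∷ []) (λ { (here refl) → v∈R }) (m≤m+n (length R) 1)
    where
    grow : ∀ fuel {h e p} → Walk h e p → Unique (h ∷ p) → h ∷ p ⊆ˡ R →
           length R ≤ fuel + length (h ∷ p) → MaximalWalk R
    grow fuel {h} {e} {p} W W! W⊆R bound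
      with Any.any? (λ z → E? h z ×-dec ¬? (Any.any? (z ≟_) (h ∷ p))) R
    ... | no stuck = maximal h e p W W! W⊆R saturated
      where
      saturated : ∀ {z} → z ∈ˡ R → E h z → z ∈ˡ p
      saturated {z} z∈R hz with Any.any? (z ≟_) (h ∷ p)
      ... | yes (here refl)  = ⊥-elim (E-irrefl hz)
      ... | yes (there z∈p) = z∈p
      ... | no  z∉          = ⊥-elim (stuck (Any.map (λ { refl → hz , z∉ }) z∈R))
    ... | yes prolongable with find prolongable
    ...   | z , z∈R , hz , z∉ = continue fuel bound
      where
      longer! : Unique (z ∷ h ∷ p)
      longer! = ¬Any⇒All¬ _ z∉ ∷ W!

      longer⊆R : z ∷ h ∷ p ⊆ˡ R
      longer⊆R (here refl) = z∈R
      longer⊆R (there u∈)  = W⊆R u∈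

      continue : ∀ fuel → length R ≤ fuel + length (h ∷ p) → MaximalWalk R
      continue zero       bound = contradiction bound (<⇒≱ (Unique⇒length≤ longer! longer⊆R))
      continue (suc fuel) bound =
        grow fuel (E-sym hz ∷ʷ W) longer! longer⊆R (subst (length R ≤_) (sym (+-suc fuel _)) bound)

  low-degree-vertex : ∀ {R v} → Unique R → All (_∈ X) R → 2 ≤ d → v ∈ˡ R →
    ∃[ x ] (x ∈ˡ R × length (filter (ClosedAdj? x) R) ≤ d)
  low-degree-vertex {R} R! R⊆X 2≤d v∈R with maximal-walk v∈R
  ... | maximal h e p W W! W⊆R saturated = h , W⊆R (here refl) , bound (split-last (E? h) p)
    where
    N : List (V G)
    N = filter (ClosedAdj? h) R

    N! : Unique N
    N! = Uniqueₚ.filter⁺ (ClosedAdj? h) R!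

    on-walk : ∀ {z} → z ∈ˡ N → z ∈ˡ h ∷ p
    on-walk z∈N with ∈-filter⁻ (ClosedAdj? h) {xs = R} z∈N
    ... | _   , inj₁ refl = here refl
    ... | z∈R , inj₂ hz   = there (saturated z∈R hz)

    bound : All (¬_ ∘ E h) p ⊎ ∃[ xs ] ∃[ y ] ∃[ ys ] (p ≡ xs ++ y ∷ ys × E h y × All (¬_ ∘ E h) ys) →
            length N ≤ d
    bound (inj₁ p≁h) = ≤-trans (Unique⇒length≤ N! N⊆h) (≤-trans (s≤s z≤n) 2≤d)
      where
      N⊆h : N ⊆ˡ h ∷ []
      N⊆h z∈N with on-walk z∈N
      ... | here z≡h = here z≡h
      ... | there z∈p with ∈-filter⁻ (ClosedAdj? h) {xs = R} z∈N
      ...   | _ , inj₁ refl = here refl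
      ...   | _ , inj₂ hz   = contradiction hz (All.lookup p≁h z∈p)
    bound (inj₂ (xs , y , ys , refl , hy , ys≁h)) =
      ≤-trans (Unique⇒length≤ N! N⊆cycle)
              (closed-walk-length≤ 2≤d xs (Walk-prefix xs W) (E-sym hy) cycle! cycle⊆X)
      where
      cycle : List (V G)
      cycle = h ∷ xs ++ y ∷ []

      split : cycle ++ ys ≡ h ∷ xs ++ y ∷ ys
      split = ++-assoc (h ∷ xs) (y ∷ []) ys
      cycle! : Unique cycle
      cycle! = Unique-++⁻ˡ cycle (subst Unique (sym split) W!)
      cycle⊆X : All (_∈ X) cycle
      cycle⊆X = All.tabulate λ {u} u∈ → All.lookup R⊆X (W⊆R (subst (u ∈ˡ_) split (∈-++⁺ˡ u∈)))
      N⊆cycle : N ⊆ˡ cycle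
      N⊆cycle z∈N with on-walk z∈N
      ... | here z≡h = here z≡h
      ... | there z∈p with ∈-++⁻ xs z∈p
      ...   | inj₁ z∈xs = there (∈-++⁺ˡ z∈xs)
      ...   | inj₂ (here z≡y) = there (∈-++⁺ʳ xs (here z≡y))
      ...   | inj₂ (there z∈ys) with ∈-filter⁻ (ClosedAdj? h) {xs = R} z∈N
      ...     | _ , inj₁ refl = here refl
      ...     | _ , inj₂ hz   = contradiction hz (All.lookup ys≁h z∈ys)

  independent-set : ∀ m {R} → Unique R → All (_∈ X) R → 2 ≤ d → d * m < length R →
    Σ (Fin (suc m) → V G) λ g → (∀ i → g i ∈ˡ R) × (∀ i j → i ≢ j → ¬ ClosedAdj (g i) (g j))
  independent-set _       {[]}    _  _   _   ()
  independent-set zero    {v ∷ _} _  _   _   _   =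
    (λ _ → v) , (λ _ → here refl) , λ { zero zero 0≢0 → contradiction refl 0≢0 }
  independent-set (suc m) {R@(_ ∷ _)} R! R⊆X 2≤d big with low-degree-vertex R! R⊆X 2≤d (here refl)
  ... | x , x∈R , N≤d with independent-set m (Uniqueₚ.filter⁺ far? R!) (Allₚ.filter⁺ far? R⊆X) 2≤d big′
    where
    far? : ∀ v → Dec (¬ ClosedAdj x v)
    far? = ¬? ∘ ClosedAdj? x

    big′ : d * m < length (filter far? R)
    big′ = +-cancelˡ-< d _ _ (begin-strict
      d + d * m                                              ≡⟨ *-suc d m ⟨
      d * suc m                                              <⟨ big ⟩
      length R                                               ≡⟨ length-filter-+ (ClosedAdj? x) R ⟨
      length (filter (ClosedAdj? x) R) + length (filter far? R) ≤⟨ +-mono-≤ N≤d ≤-refl ⟩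
      d + length (filter far? R)                             ∎)
      where open ≤-Reasoning
  ... | g , g∈ , g-apart = g′ , g′∈ , g′-apart
    where
    far : ∀ i → g i ∈ˡ R × ¬ ClosedAdj x (g i)
    far i = ∈-filter⁻ (¬? ∘ ClosedAdj? x) {xs = R} (g∈ i)

    g′ : Fin (suc (suc m)) → V G
    g′ zero    = x
    g′ (suc i) = g i

    g′∈ : ∀ i → g′ i ∈ˡ R
    g′∈ zero    = x∈R
    g′∈ (suc i) = proj₁ (far i)

    g′-apart : ∀ i j → i ≢ j → ¬ ClosedAdj (g′ i) (g′ j)
    g′-apart zero    zero    0≢0 = contradiction refl 0≢0
    g′-apart zero    (suc j) _   = proj₂ (far j)
    g′-apart (suc i) zero    _   = proj₂ (far i) ∘ ClosedAdj-sym
    g′-apart (suc i) (suc j) i≢j = g-apart i j (i≢j ∘ cong suc)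

many-type1-terminals⇒¬sP3Free : ∀ G C X → BlockGraph G C X → ∀ X' → X' ⊆ X → ∀ root m {k}
  (t : Fin k → V G) → Injective _≡_ _≡_ t → (∀ i → Type1 G X' root (t i)) → maxOrder C * m < k →
  ¬ sP3Free (suc m) G
many-type1-terminals⇒¬sP3Free G C X C-blocks X' X'⊆X root m {suc k} t t-injective type1 many free =
  case independent-set m (Uniqueₚ.map⁺ t-injective (Uniqueₚ.allFin⁺ (suc k))) R⊆X 2≤d big
    of λ (g , g∈ , g-apart) → cherries⇒¬sP3Free g (cherry-at ∘ g∈) g-apart free
  where
  open Walks G
  open LeafChildren G X' root
  open BlockGraphs G C X C-blocks

  R : List (V G)
  R = map t (allFin (suc k))

  cherry-at : ∀ {v} → v ∈ˡ R → Cherry v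
  cherry-at v∈R with ∈-map⁻ t v∈R
  ... | i , _ , refl = Type1⇒Cherry (type1 i)

  R⊆X : All (_∈ X) R
  R⊆X = All.tabulate λ v∈R → X'⊆X (proj₁ (Cherry.cut (cherry-at v∈R)))

  2≤d : 2 ≤ d
  2≤d with LeafChild⇒Block (Arm.leaf (Cherry.arm₁ (cherry-at (here refl))))
  ... | B⊆X' , B-bic , _ = Biconnected⇒2≤d (λ v∈B → X'⊆X (B⊆X' v∈B)) B-bic

  big : d * m < length R
  big = subst (d * m <_) (sym (trans (length-map t (allFin (suc k))) (length-tabulate id))) many

lemma4 : (s : ℕ) → 1 ≤ s → (C : List Graph) → All BiconnectedGraph C
    → (G : Graph) → sP3Free s G
    → (X : Subset (n G)) → BlockGraph G C X
    → (X' : Subset (n G)) → RemoveTrivial G X X'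
    → (root : Fin (n G) → Fin (n G)) → RootChoice G X' root
    → (k : ℕ) (t : Fin k → Fin (n G)) → Injective _≡_ _≡_ t
    → (∀ i → Type1 G X' root (t i))
    → k ≤ maxOrder C * (s ∸ 1)
lemma4 s _ C _ G _ X _ _ _ _ _ k _ _ _ with k ≤? maxOrder C * (s ∸ 1)
... | yes k≤ = k≤
lemma4 (suc m) (s≤s z≤n) C _ G free X C-blocks X' F′ root _ k t t-injective type1 | no k≰ =
  ⊥-elim (many-type1-terminals⇒¬sP3Free G C X C-blocks X' X'⊆X root m t t-injective type1 (≰⇒> k≰) free)
  where
  X'⊆X : X' ⊆ X
  X'⊆X {v} v∈X' = proj₁ (Equivalence.to (F′ v) v∈X')
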